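{- Let $G$ and $H$ be finite simple graphs, let $\mathscr{C}$ be a clique cover of $G$ with $|\mathscr{C}|=q$, and let $U\subseteq V(H)$ with $\alpha(H)=\alpha(H-U)+2$. Then: (i) if both $I(H;x)$ and $I(H-U;x)$ are symmetric, then $I(G^{\mathscr{C}}\star H^U;x)$ is symmetric; (ii) if both $I(H;x)$ and $I(H-U;x)$ are symmetric and unimodal, then $I(G^{\mathscr{C}}\star H^U;x)$ is symmetric and unimodal.
   Context: For a finite simple graph $G$, $i_k(G)$ is the number of independent sets of size $k$ ($i_0(G)=1$), $\alpha(G)$ is the maximum size of an independent set, and $I(G;x)=\sum_{k=0}^{\alpha(G)} i_k(G)x^k$ is the independence polynomial; $H-U$ is the subgraph induced on $V(H)\setminus U$. A clique cover of $G$ is a spanning subgraph each of whose components is a clique; we view it as the set $\mathscr{C}$ of these cliques, which partition $V(G)$. The clique cover product $G^{\mathscr{C}}\star H^U$ is obtained from $G$ by, for each clique $C\in\mathscr{C}$, adding a new disjoint copy of $H$ and joining every vertex of $C$ to every vertex of the copy of $U$ in that copy of $H$. A polynomial $\sum_{k=0}^n a_kx^k$ of degree $n$ with nonnegative coefficients is symmetric if $a_k=a_{n-k}$ for $0\le k\le n$, and unimodal if there is $m$ with $a_0\le a_1\le\cdots\le a_m\ge a_{m+1}\ge\cdots\ge a_n$. -}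

module Defs where

open import Data.Bool using (Bool; true; false; _∧_; not; if_then_else_)
open import Data.Nat using (ℕ; zero; suc; _+_; _*_; _∸_; _≤_; _<_; _⊔_)
open import Data.Fin using (Fin; splitAt; remQuot)
open import Data.Fin.Properties using () renaming (_≟_ to _≟F_)
open import Data.Fin.Subset using (Subset; ∣_∣; ∁; _∈_; _⊆_)
open import Data.Vec using (Vec; []; _∷_; lookup)
open import Data.List using (List; []; _∷_; map; _++_; foldr; filter; length; allFin)
open import Data.Sum using (_⊎_; inj₁; inj₂)
open import Data.Product using (_×_; _,_; ∃; Σ-syntax)
open import Relation.Nullary using (¬_)
open import Relation.Nullary.Decidable using (⌊_⌋)
open import Relation.Binary.PropositionalEquality using (_≡_; _≢_)

record Graph (n : ℕ) : Set where
  field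
    adj        : Fin n → Fin n → Bool
    adj-sym    : ∀ u v → adj u v ≡ adj v u
    adj-irrefl : ∀ v → adj v v ≡ false
open Graph public

-- Everything below is phrased for an adjacency relation
-- (adj : Fin n → Fin n → Bool) together with a vertex set
-- W : Subset n; the graph considered is the subgraph induced on W.
-- For W = ⊤ this is the whole graph; H - U is (H , ∁ U).

allSubsets : (n : ℕ) → List (Subset n)
allSubsets zero    = [] ∷ []
allSubsets (suc n) = map (true ∷_) (allSubsets n) ++ map (false ∷_) (allSubsets n)

subsetᵇ : ∀ {n} → Subset n → Subset n → Bool
subsetᵇ []      []      = true
subsetᵇ (s ∷ S) (w ∷ W) = (not s Data.Bool.∨ w) ∧ subsetᵇ S W

allᵇ : ∀ {A : Set} → (A → Bool) → List A → Bool
allᵇ p = foldr (λ x b → p x ∧ b) true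

independentᵇ : ∀ {n} → (Fin n → Fin n → Bool) → Subset n → Bool
independentᵇ {n} adj S =
  allᵇ (λ u → allᵇ (λ v → not (lookup S u ∧ lookup S v ∧ adj u v)) (allFin n)) (allFin n)

indepSets : ∀ {n} → (Fin n → Fin n → Bool) → Subset n → List (Subset n)
indepSets {n} adj W =
  filter (λ S → Data.Bool._≟_ (subsetᵇ S W ∧ independentᵇ adj S) true) (allSubsets n)

indepCount : ∀ {n} → (Fin n → Fin n → Bool) → Subset n → ℕ → ℕ
indepCount adj W k = length (filter (λ S → Data.Nat._≟_ ∣ S ∣ k) (indepSets adj W))

indepNum : ∀ {n} → (Fin n → Fin n → Bool) → Subset n → ℕ
indepNum adj W = foldr (λ S m → ∣ S ∣ ⊔ m) 0 (indepSets adj W)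

-- Polynomials with natural coefficients, given by a coefficient
-- function a : ℕ → ℕ and a degree d (coefficients beyond d are ignored).

Symmetric : (ℕ → ℕ) → ℕ → Set
Symmetric a d = ∀ k → k ≤ d → a k ≡ a (d ∸ k)

Unimodal : (ℕ → ℕ) → ℕ → Set
Unimodal a d = ∃ λ m → m ≤ d
  × (∀ k → k < m → a k ≤ a (suc k))
  × (∀ k → m ≤ k → k < d → a (suc k) ≤ a k)

IndepSymmetric : ∀ {n} → (Fin n → Fin n → Bool) → Subset n → Set
IndepSymmetric adj W = Symmetric (indepCount adj W) (indepNum adj W)

IndepUnimodal : ∀ {n} → (Fin n → Fin n → Bool) → Subset n → Set
IndepUnimodal adj W = Unimodal (indepCount adj W) (indepNum adj W)

-- Clique covers: a partition of V(G) into q (nonempty) cliques,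
-- encoded by the map sending each vertex to its clique.

record CliqueCover {n : ℕ} (G : Graph n) (q : ℕ) : Set where
  field
    cls    : Fin n → Fin q
    nonempty : ∀ (C : Fin q) → ∃ λ v → cls v ≡ C
    clique : ∀ u v → cls u ≡ cls v → u ≢ v → adj G u v ≡ true
open CliqueCover public

-- Vertex set Fin (n + q * m): the first n are V(G); a vertex w of the
-- second block with remQuot m w = (C , h) is vertex h of the copy of H
-- attached to clique C.

eqFᵇ : ∀ {k} → Fin k → Fin k → Bool
eqFᵇ i j = ⌊ i ≟F j ⌋

productAdj : ∀ {n m q} (G : Graph n) → CliqueCover G q → Graph m → Subset m →
             Fin (n + q * m) → Fin (n + q * m) → Bool
productAdj {n} {m} {q} G 𝒞 H U u v with splitAt n u | splitAt n v
... | inj₁ g | inj₁ g' = adj G g g'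
... | inj₁ g | inj₂ w  with remQuot {q} m w
...   | (C , h) = eqFᵇ (cls 𝒞 g) C ∧ lookup U h
productAdj {n} {m} {q} G 𝒞 H U u v | inj₂ w | inj₁ g with remQuot {q} m w
...   | (C , h) = eqFᵇ (cls 𝒞 g) C ∧ lookup U h
productAdj {n} {m} {q} G 𝒞 H U u v | inj₂ w | inj₂ w' with remQuot {q} m w | remQuot {q} m w'
...   | (C , h) | (C' , h') = eqFᵇ C C' ∧ adj H h h'

module Submission where

-- An independent set of the product is an independent set S₁ of G together
-- with an independent set in each copy of H, which must avoid U exactly in
-- the copies whose clique S₁ meets; an independent S₁ meets |S₁| cliques.
-- Hence I(G^𝒞 ⋆ H^U) = Σ_{S₁} x ^ |S₁| · I(H - U) ^ |S₁| · I(H) ^ (q - |S₁|).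
-- Writing α′ = α(H - U), the S₁-term is palindromic of degree
-- 2 |S₁| + |S₁| α′ + (q - |S₁|) (α′ + 2) = q (α′ + 2), whatever S₁ is; and
-- palindromic (unimodal) polynomials with a common centre are closed under
-- sums, while products of palindromic (unimodal) polynomials are again so.

open import Defs
open import Data.Bool as Bool using (Bool; true; false; _∧_; _∨_; not; T; if_then_else_)
open import Data.Bool.Properties using (∧-zeroʳ; ∧-identityʳ; ∨-zeroʳ; ∧-conicalˡ; ∧-conicalʳ)
open import Data.Empty using (⊥-elim)
open import Data.Fin as Fin using (Fin; _↑ˡ_; _↑ʳ_)
open import Data.Fin.Properties
  using (splitAt-↑ˡ; splitAt-↑ʳ; splitAt⁻¹-↑ˡ; splitAt⁻¹-↑ʳ; remQuot-combine; combine-remQuot)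
  renaming (_≟_ to _≟F_; suc-injective to Fin-suc-injective)
open import Data.Fin.Subset using (Subset; ∣_∣; ⊤; ∁)
open import Data.List using (List; []; _∷_; map; filter; length; allFin; foldr) renaming (_++_ to _++ˡ_)
open import Data.List.Membership.Propositional using (_∈_)
open import Data.List.Membership.Propositional.Properties using (∈-allFin)
open import Data.List.Relation.Unary.Any using (here; there)
open import Data.Nat using (ℕ; zero; suc; _+_; _*_; _∸_; _≤_; _<_; z≤n; s≤s; _≡ᵇ_; _⊔_; _≤?_; _<?_)
open import Data.Nat.Properties
open import Algebra.Properties.CommutativeMonoid.Sum +-0-commutativeMonoid
  using (sum; ∑-comm; sum-cong-≗; sum-replicate-zero)
open import Data.Nat.Solver using (module +-*-Solver)
open import Data.Product using (_×_; _,_; proj₁; proj₂; ∃)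
open import Data.Sum using (_⊎_; inj₁; inj₂)
open import Data.Vec using (Vec; []; _∷_; lookup; replicate; take; drop; concat) renaming (_++_ to _++ᵛ_)
open import Data.Vec.Properties
  using (lookup-replicate; lookup-map; lookup-++ˡ; lookup-++ʳ; lookup-concat; take++drop≡id; ++-injectiveˡ; ++-injectiveʳ)
open import Function using (_∘_)
open import Relation.Binary.Definitions using (tri<; tri≈; tri>)
open import Relation.Binary.PropositionalEquality
open import Relation.Nullary using (yes; no; does)
open import Relation.Nullary.Decidable using (decidable-stable)
open import Relation.Unary using (Pred; Decidable)
open +-*-Solver using (solve; _:+_; _:=_; con)

Poly : Set
Poly = ℕ → ℕ

0p 1p : Poly
0p _ = 0
1p zero    = 1
1p (suc _) = 0

infixl 6 _⊕_
_⊕_ : Poly → Poly → Poly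
(a ⊕ b) k = a k + b k

scale : ℕ → Poly → Poly
scale c a k = c * a k

shift : Poly → Poly
shift a zero    = 0
shift a (suc k) = a k

shiftBy : ℕ → Poly → Poly
shiftBy zero    a = a
shiftBy (suc j) a = shift (shiftBy j a)

-- the product, by recursion on the first factor:  a · b = a₀ b + x (a ∘ suc) b
mul : Poly → Poly → Poly
mul a b zero    = a 0 * b 0
mul a b (suc k) = a 0 * b (suc k) + mul (a ∘ suc) b k

below : ℕ → Poly → Poly
below zero    a k       = 0
below (suc D) a zero    = a 0
below (suc D) a (suc k) = below D (a ∘ suc) k

ones : ℕ → Poly
ones D = below (suc D) (λ _ → 1)

window : ℕ → Poly → Poly
window zero    b = b
window (suc D) b = b ⊕ shift (window D b)

≗-sym : ∀ {a b : Poly} → a ≗ b → b ≗ a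
≗-sym e k = sym (e k)

≗-trans : ∀ {a b c : Poly} → a ≗ b → b ≗ c → a ≗ c
≗-trans e f k = trans (e k) (f k)

shift-cong : ∀ {a b} → a ≗ b → shift a ≗ shift b
shift-cong e zero    = refl
shift-cong e (suc k) = e k

⊕-cong : ∀ {a a′ b b′} → a ≗ a′ → b ≗ b′ → a ⊕ b ≗ a′ ⊕ b′
⊕-cong e f k = cong₂ _+_ (e k) (f k)

scale-cong : ∀ c {a b} → a ≗ b → scale c a ≗ scale c b
scale-cong c e k = cong (c *_) (e k)

shiftBy-cong : ∀ j {a b} → a ≗ b → shiftBy j a ≗ shiftBy j b
shiftBy-cong zero    e = e
shiftBy-cong (suc j) e = shift-cong (shiftBy-cong j e)

mul-cong : ∀ {a a′ b b′} → a ≗ a′ → b ≗ b′ → mul a b ≗ mul a′ b′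
mul-cong e f zero    = cong₂ _*_ (e 0) (f 0)
mul-cong e f (suc k) = cong₂ _+_ (cong₂ _*_ (e 0) (f (suc k))) (mul-cong (e ∘ suc) f k)

shift-0p : shift 0p ≗ 0p
shift-0p zero    = refl
shift-0p (suc k) = refl

shiftBy-0p : ∀ j → shiftBy j 0p ≗ 0p
shiftBy-0p zero    k = refl
shiftBy-0p (suc j) k = trans (shift-cong (shiftBy-0p j) k) (shift-0p k)

shiftBy-shift : ∀ j a → shiftBy j (shift a) ≗ shift (shiftBy j a)
shiftBy-shift zero    a k = refl
shiftBy-shift (suc j) a   = shift-cong (shiftBy-shift j a)

shiftBy-⊕ : ∀ j a b → shiftBy j (a ⊕ b) ≗ shiftBy j a ⊕ shiftBy j b
shiftBy-⊕ zero    a b k       = refl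
shiftBy-⊕ (suc j) a b zero    = refl
shiftBy-⊕ (suc j) a b (suc k) = shiftBy-⊕ j a b k

shiftBy-≥ : ∀ j b t → shiftBy j b (j + t) ≡ b t
shiftBy-≥ zero    b t = refl
shiftBy-≥ (suc j) b t = shiftBy-≥ j b t

shiftBy-< : ∀ j b k → k < j → shiftBy j b k ≡ 0
shiftBy-< (suc j) b zero    _         = refl
shiftBy-< (suc j) b (suc k) (s≤s k<j) = shiftBy-< j b k k<j

below-< : ∀ D a k → k < D → below D a k ≡ a k
below-< (suc D) a zero    _         = refl
below-< (suc D) a (suc k) (s≤s k<D) = below-< D (a ∘ suc) k k<D

below-≥ : ∀ D a k → D ≤ k → below D a k ≡ 0
below-≥ zero    a k       _         = refl
below-≥ (suc D) a (suc k) (s≤s D≤k) = below-≥ D (a ∘ suc) k D≤k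

mul-⊕ˡ : ∀ a a′ b → mul (a ⊕ a′) b ≗ mul a b ⊕ mul a′ b
mul-⊕ˡ a a′ b zero    = *-distribʳ-+ (b 0) (a 0) (a′ 0)
mul-⊕ˡ a a′ b (suc k) = begin
    (a 0 + a′ 0) * b (suc k) + mul (a ∘ suc ⊕ a′ ∘ suc) b k
  ≡⟨ cong₂ _+_ (*-distribʳ-+ (b (suc k)) (a 0) (a′ 0)) (mul-⊕ˡ (a ∘ suc) (a′ ∘ suc) b k) ⟩
    (a 0 * b (suc k) + a′ 0 * b (suc k)) + (mul (a ∘ suc) b k + mul (a′ ∘ suc) b k)
  ≡⟨ interchange (a 0 * b (suc k)) _ _ _ ⟩
    (a 0 * b (suc k) + mul (a ∘ suc) b k) + (a′ 0 * b (suc k) + mul (a′ ∘ suc) b k)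
  ∎
  where
  open ≡-Reasoning
  interchange : ∀ w x y z → (w + x) + (y + z) ≡ (w + y) + (x + z)
  interchange = solve 4 (λ w x y z → (w :+ x) :+ (y :+ z) := (w :+ y) :+ (x :+ z)) refl

mul-shiftˡ : ∀ a b → mul (shift a) b ≗ shift (mul a b)
mul-shiftˡ a b zero    = refl
mul-shiftˡ a b (suc k) = refl

mul-shiftByˡ : ∀ j a b → mul (shiftBy j a) b ≗ shiftBy j (mul a b)
mul-shiftByˡ zero    a b k = refl
mul-shiftByˡ (suc j) a b   = ≗-trans (mul-shiftˡ (shiftBy j a) b) (shift-cong (mul-shiftByˡ j a b))

mul-scaleˡ : ∀ c a b → mul (scale c a) b ≗ scale c (mul a b)
mul-scaleˡ c a b zero    = *-assoc c (a 0) (b 0)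
mul-scaleˡ c a b (suc k) = begin
    c * a 0 * b (suc k) + mul (scale c (a ∘ suc)) b k
  ≡⟨ cong₂ _+_ (*-assoc c (a 0) (b (suc k))) (mul-scaleˡ c (a ∘ suc) b k) ⟩
    c * (a 0 * b (suc k)) + c * mul (a ∘ suc) b k
  ≡⟨ *-distribˡ-+ c _ _ ⟨
    c * (a 0 * b (suc k) + mul (a ∘ suc) b k)
  ∎
  where open ≡-Reasoning

mul-0pˡ : ∀ b → mul 0p b ≗ 0p
mul-0pˡ b zero    = refl
mul-0pˡ b (suc k) = mul-0pˡ b k

mul-1pˡ : ∀ b → mul 1p b ≗ b
mul-1pˡ b zero    = +-identityʳ (b 0)
mul-1pˡ b (suc k) = trans (cong₂ _+_ (+-identityʳ (b (suc k))) (mul-0pˡ b k)) (+-identityʳ _)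

mul-split : ∀ c p r b → mul (scale c p ⊕ shift r) b ≗ scale c (mul p b) ⊕ shift (mul r b)
mul-split c p r b = ≗-trans (mul-⊕ˡ (scale c p) (shift r) b)
                            (⊕-cong (mul-scaleˡ c p b) (mul-shiftˡ r b))

ones-suc : ∀ D → ones (suc D) ≗ 1p ⊕ shift (ones D)
ones-suc D zero    = refl
ones-suc D (suc k) = refl

mul-ones : ∀ D b → mul (ones D) b ≗ window D b
mul-ones zero    b = ≗-trans (mul-cong ones-zero (λ _ → refl)) (mul-1pˡ b)
  where
  ones-zero : ones 0 ≗ 1p
  ones-zero zero    = refl
  ones-zero (suc k) = refl
mul-ones (suc D) b =
  ≗-trans (mul-cong (ones-suc D) (λ _ → refl))
  (≗-trans (mul-⊕ˡ 1p (shift (ones D)) b)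
  (⊕-cong (mul-1pˡ b) (≗-trans (mul-shiftˡ (ones D) b) (shift-cong (mul-ones D b)))))

mul-1p+x^D : ∀ D b → mul (1p ⊕ shiftBy D 1p) b ≗ b ⊕ shiftBy D b
mul-1p+x^D D b = ≗-trans (mul-⊕ˡ 1p (shiftBy D 1p) b)
  (⊕-cong (mul-1pˡ b) (≗-trans (mul-shiftByˡ D 1p b) (shiftBy-cong D (mul-1pˡ b))))

-- Such polynomials
-- are "centred at D / 2", and are closed under sums, scalars, x² · _
-- (which moves the centre by one) and products (which add the D's).

record Palindromic (D : ℕ) (a : Poly) : Set where
  field
    mirror : ∀ k → k ≤ D → a k ≡ a (D ∸ k)
    vanish : ∀ k → D < k → a k ≡ 0
open Palindromic

pal-cong : ∀ {D a b} → a ≗ b → Palindromic D a → Palindromic D b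
pal-cong e pa .mirror k k≤D = trans (sym (e k)) (trans (mirror pa k k≤D) (e _))
pal-cong e pa .vanish k D<k = trans (sym (e k)) (vanish pa k D<k)

pal-0p : ∀ {D} → Palindromic D 0p
pal-0p .mirror _ _ = refl
pal-0p .vanish _ _ = refl

pal-1p : Palindromic 0 1p
pal-1p .mirror zero _    = refl
pal-1p .vanish (suc k) _ = refl

pal-⊕ : ∀ {D a b} → Palindromic D a → Palindromic D b → Palindromic D (a ⊕ b)
pal-⊕ pa pb .mirror k k≤D = cong₂ _+_ (mirror pa k k≤D) (mirror pb k k≤D)
pal-⊕ pa pb .vanish k D<k = cong₂ _+_ (vanish pa k D<k) (vanish pb k D<k)

pal-scale : ∀ {D a} c → Palindromic D a → Palindromic D (scale c a)
pal-scale c pa .mirror k k≤D = cong (c *_) (mirror pa k k≤D)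
pal-scale c pa .vanish k D<k = trans (cong (c *_) (vanish pa k D<k)) (*-zeroʳ c)

pal-shift : ∀ {D a} → Palindromic D a → Palindromic (suc (suc D)) (shift a)
pal-shift {D} pa .mirror zero _ = sym (vanish pa (suc D) (n<1+n D))
pal-shift {D} {a} pa .mirror (suc k) (s≤s k≤1+D) with m≤n⇒m<n∨m≡n k≤1+D
... | inj₁ (s≤s k≤D) = trans (mirror pa k k≤D) (cong (shift a) (sym (+-∸-assoc 1 k≤D)))
... | inj₂ refl      = trans (vanish pa (suc D) (n<1+n D)) (cong (shift a) (sym (n∸n≡0 (suc D))))
pal-shift {D} pa .vanish (suc k) (s≤s D+1<k) = vanish pa k (<-trans (n<1+n D) D+1<k)

pal-mirrorSum : ∀ D E {b} → Palindromic E b → Palindromic (D + E) (b ⊕ shiftBy D b)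
pal-mirrorSum D E {b} pb = record { mirror = mirrorSum ; vanish = vanishSum }
  where
  -- each summand is the reflection of the other
  reflect : ∀ k → k ≤ D + E → b k ≡ shiftBy D b (D + E ∸ k)
  reflect k k≤D+E with k ≤? E
  ... | yes k≤E = begin
      b k                          ≡⟨ mirror pb k k≤E ⟩
      b (E ∸ k)                    ≡⟨ shiftBy-≥ D b (E ∸ k) ⟨
      shiftBy D b (D + (E ∸ k))    ≡⟨ cong (shiftBy D b) (+-∸-assoc D k≤E) ⟨
      shiftBy D b (D + E ∸ k)      ∎
    where open ≡-Reasoning
  ... | no k≰E = trans (vanish pb k E<k) (sym (shiftBy-< D b (D + E ∸ k) D+E∸k<D))
    where
    E<k = ≰⇒> k≰E
    D+E∸k<D : D + E ∸ k < D
    D+E∸k<D = subst (D + E ∸ k <_) (m+n∸n≡m D E) (∸-monoʳ-< E<k k≤D+E)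
  reflect′ : ∀ k → k ≤ D + E → shiftBy D b k ≡ b (D + E ∸ k)
  reflect′ k k≤D+E = sym (trans (reflect (D + E ∸ k) (m∸n≤m (D + E) k))
                                (cong (shiftBy D b) (m∸[m∸n]≡n k≤D+E)))
  mirrorSum : ∀ k → k ≤ D + E → b k + shiftBy D b k ≡ b (D + E ∸ k) + shiftBy D b (D + E ∸ k)
  mirrorSum k k≤D+E = trans (cong₂ _+_ (reflect k k≤D+E) (reflect′ k k≤D+E)) (+-comm (shiftBy D b (D + E ∸ k)) _)
  vanishSum : ∀ k → D + E < k → b k + shiftBy D b k ≡ 0
  vanishSum k D+E<k with m≤n⇒∃[o]m+o≡n (≤-trans (m≤m+n D E) (<⇒≤ D+E<k))
  ... | t , refl = cong₂ _+_ (vanish pb (D + t) (<-≤-trans (s≤s (m≤n+m E D)) D+E<k))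
                             (trans (shiftBy-≥ D b t) (vanish pb t (+-cancelˡ-< D E t D+E<k)))

shiftBy-1p-≡ : ∀ D → shiftBy D 1p D ≡ 1
shiftBy-1p-≡ zero    = refl
shiftBy-1p-≡ (suc D) = shiftBy-1p-≡ D

shiftBy-1p-≢ : ∀ D k → k ≢ D → shiftBy D 1p k ≡ 0
shiftBy-1p-≢ zero    zero    k≢D = ⊥-elim (k≢D refl)
shiftBy-1p-≢ zero    (suc k) _   = refl
shiftBy-1p-≢ (suc D) zero    _   = refl
shiftBy-1p-≢ (suc D) (suc k) k≢D = shiftBy-1p-≢ D k (k≢D ∘ cong suc)

interior : ℕ → Poly → Poly
interior D a = below D (a ∘ suc)

pal-peel : ∀ D {a} → Palindromic (suc D) a →
           a ≗ scale (a 0) (1p ⊕ shiftBy (suc D) 1p) ⊕ shift (interior D a)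
pal-peel D {a} pa zero = sym (trans (cong (_+ 0) (*-identityʳ (a 0))) (+-identityʳ (a 0)))
pal-peel D {a} pa (suc k) with <-cmp k D
... | tri< k<D _ _ = sym (begin
    a 0 * shiftBy D 1p k + below D (a ∘ suc) k
  ≡⟨ cong₂ (λ s t → a 0 * s + t) (shiftBy-1p-≢ D k (<⇒≢ k<D)) (below-< D (a ∘ suc) k k<D) ⟩
    a 0 * 0 + a (suc k)
  ≡⟨ cong (_+ a (suc k)) (*-zeroʳ (a 0)) ⟩
    a (suc k)
  ∎)
  where open ≡-Reasoning
... | tri≈ _ refl _ = sym (begin
    a 0 * shiftBy k 1p k + below k (a ∘ suc) k
  ≡⟨ cong₂ (λ s t → a 0 * s + t) (shiftBy-1p-≡ k) (below-≥ k (a ∘ suc) k ≤-refl) ⟩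
    a 0 * 1 + 0
  ≡⟨ trans (+-identityʳ _) (*-identityʳ (a 0)) ⟩
    a 0
  ≡⟨ cong a (n∸n≡0 (suc k)) ⟨
    a (suc k ∸ suc k)
  ≡⟨ mirror pa (suc k) ≤-refl ⟨
    a (suc k)
  ∎)
  where open ≡-Reasoning
... | tri> _ _ D<k = sym (begin
    a 0 * shiftBy D 1p k + below D (a ∘ suc) k
  ≡⟨ cong₂ (λ s t → a 0 * s + t) (shiftBy-1p-≢ D k (>⇒≢ D<k)) (below-≥ D (a ∘ suc) k (<⇒≤ D<k)) ⟩
    a 0 * 0 + 0
  ≡⟨ cong (_+ 0) (*-zeroʳ (a 0)) ⟩
    0
  ≡⟨ vanish pa (suc k) (s≤s D<k) ⟨
    a (suc k)
  ∎)
  where open ≡-Reasoning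

pal-interior : ∀ D {a} → Palindromic (suc (suc D)) a → Palindromic D (interior (suc D) a)
pal-interior D {a} pa .mirror k k≤D = begin
    below (suc D) (a ∘ suc) k          ≡⟨ below-< (suc D) (a ∘ suc) k (s≤s k≤D) ⟩
    a (suc k)                          ≡⟨ mirror pa (suc k) (s≤s (m≤n⇒m≤1+n k≤D)) ⟩
    a (suc D ∸ k)                      ≡⟨ cong a (+-∸-assoc 1 k≤D) ⟩
    a (suc (D ∸ k))                    ≡⟨ below-< (suc D) (a ∘ suc) (D ∸ k) (s≤s (m∸n≤m D k)) ⟨
    below (suc D) (a ∘ suc) (D ∸ k)    ∎
  where open ≡-Reasoning
pal-interior D {a} pa .vanish k D<k = below-≥ (suc D) (a ∘ suc) k D<k

mul-peeled : ∀ D {a} b → Palindromic (suc D) a →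
  mul a b ≗ scale (a 0) (b ⊕ shiftBy (suc D) b) ⊕ shift (mul (interior D a) b)
mul-peeled D {a} b pa =
  ≗-trans (mul-cong (pal-peel D pa) (λ _ → refl))
  (≗-trans (mul-split (a 0) (1p ⊕ shiftBy (suc D) 1p) (interior D a) b)
           (⊕-cong (scale-cong (a 0) (mul-1p+x^D (suc D) b)) (λ _ → refl)))

pal-mul : ∀ D E {a b} → Palindromic D a → Palindromic E b → Palindromic (D + E) (mul a b)
pal-mul zero E {a} {b} pa pb = pal-cong (≗-sym product) (pal-scale (a 0) pb)
  where
  constant : a ≗ scale (a 0) 1p
  constant zero    = sym (*-identityʳ (a 0))
  constant (suc k) = trans (vanish pa (suc k) (s≤s z≤n)) (sym (*-zeroʳ (a 0)))
  product : mul a b ≗ scale (a 0) b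
  product = ≗-trans (mul-cong constant (λ _ → refl))
            (≗-trans (mul-scaleˡ (a 0) 1p b) (scale-cong (a 0) (mul-1pˡ b)))
pal-mul (suc D) E {a} {b} pa pb =
  pal-cong (≗-sym (mul-peeled D b pa))
           (pal-⊕ (pal-scale (a 0) (pal-mirrorSum (suc D) E pb)) (interior-part D pa))
  where
  interior-part : ∀ D {a} → Palindromic (suc D) a → Palindromic (suc D + E) (shift (mul (interior D a) b))
  interior-part zero    _  = pal-cong (≗-sym (≗-trans (shift-cong (mul-0pˡ b)) shift-0p)) pal-0p
  interior-part (suc D) pa = pal-shift (pal-mul D E (pal-interior D pa) pb)

-- For a palindromic polynomial,
-- unimodality amounts to the coefficients not decreasing up to the
-- centre D / 2; this class has the same closure properties.

record PalUnimodal (D : ℕ) (a : Poly) : Set where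
  field
    palindromic : Palindromic D a
    rising      : ∀ k → suc (suc (k + k)) ≤ D → a k ≤ a (suc k)
open PalUnimodal

-- the rise extends to the middle step when D is odd
rising-odd : ∀ {D a} → PalUnimodal D a → ∀ i → suc (i + i) ≤ D → a i ≤ a (suc i)
rising-odd {D} {a} pu i 2i+1≤D with m≤n⇒m<n∨m≡n 2i+1≤D
... | inj₁ 2i+2≤D = rising pu i 2i+2≤D
... | inj₂ refl   = ≤-reflexive (sym (trans (mirror (palindromic pu) (suc i) (s≤s (m≤m+n i i)))
                                            (cong a (m+n∸n≡m i i))))

rising-chain : ∀ {D a} → PalUnimodal D a → ∀ i m → i ≤ m → m + m ≤ D → a i ≤ a m
rising-chain pu zero zero _ _ = ≤-refl
rising-chain {D} pu i (suc m) i≤1+m 2m+2≤D with m≤n⇒m<n∨m≡n i≤1+m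
... | inj₂ refl      = ≤-refl
... | inj₁ (s≤s i≤m) = ≤-trans (rising-chain pu i m i≤m (≤-trans (n≤1+n _) 2m+1≤D))
                               (rising-odd pu m 2m+1≤D)
  where
  2m+1≤D : suc (m + m) ≤ D
  2m+1≤D = ≤-trans (n≤1+n _) (subst (_≤ D) (cong suc (+-suc m m)) 2m+2≤D)

-- coefficients grow towards the centre: a i ≤ a j when j is at least as
-- close to D / 2 as i is, from the same side or the other
towards-centre : ∀ {D a} → PalUnimodal D a → ∀ i j → i ≤ j → i + j ≤ D → a i ≤ a j
towards-centre {D} {a} pu i j i≤j i+j≤D with (j + j) ≤? D
... | yes 2j≤D = rising-chain pu i j i≤j 2j≤D
... | no 2j≰D  = subst (a i ≤_) (sym (mirror (palindromic pu) j j≤D))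
                       (rising-chain pu i (D ∸ j) i≤D∸j 2[D∸j]≤D)
  where
  j≤D : j ≤ D
  j≤D = ≤-trans (m≤n+m j i) i+j≤D
  i≤D∸j : i ≤ D ∸ j
  i≤D∸j = subst (_≤ D ∸ j) (m+n∸n≡m i j) (∸-monoˡ-≤ j i+j≤D)
  D∸j≤j : D ∸ j ≤ j
  D∸j≤j = subst (D ∸ j ≤_) (m+n∸n≡m j j) (∸-monoˡ-≤ j (<⇒≤ (≰⇒> 2j≰D)))
  2[D∸j]≤D : (D ∸ j) + (D ∸ j) ≤ D
  2[D∸j]≤D = subst ((D ∸ j) + (D ∸ j) ≤_) (m∸n+n≡m j≤D) (+-monoʳ-≤ (D ∸ j) D∸j≤j)

pu-cong : ∀ {D a b} → a ≗ b → PalUnimodal D a → PalUnimodal D b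
pu-cong e pu .palindromic = pal-cong e (palindromic pu)
pu-cong e pu .rising k h  = subst₂ _≤_ (e k) (e (suc k)) (rising pu k h)

pu-0p : ∀ {D} → PalUnimodal D 0p
pu-0p .palindromic = pal-0p
pu-0p .rising _ _  = z≤n

pu-1p : PalUnimodal 0 1p
pu-1p .palindromic = pal-1p
pu-1p .rising _ ()

pu-⊕ : ∀ {D a b} → PalUnimodal D a → PalUnimodal D b → PalUnimodal D (a ⊕ b)
pu-⊕ pa pb .palindromic = pal-⊕ (palindromic pa) (palindromic pb)
pu-⊕ pa pb .rising k h  = +-mono-≤ (rising pa k h) (rising pb k h)

pu-scale : ∀ {D a} c → PalUnimodal D a → PalUnimodal D (scale c a)
pu-scale c pa .palindromic = pal-scale c (palindromic pa)
pu-scale c pa .rising k h  = *-monoʳ-≤ c (rising pa k h)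

pu-shift : ∀ {D a} → PalUnimodal D a → PalUnimodal (suc (suc D)) (shift a)
pu-shift pa .palindromic = pal-shift (palindromic pa)
pu-shift pa .rising zero    _                 = z≤n
pu-shift {D} pa .rising (suc k) (s≤s (s≤s h)) = rising pa k (subst (_≤ D) (cong suc (+-suc k k)) h)

pal-ones : ∀ D → Palindromic D (ones D)
pal-ones D .mirror k k≤D = trans (below-< (suc D) (λ _ → 1) k (s≤s k≤D))
                                 (sym (below-< (suc D) (λ _ → 1) (D ∸ k) (s≤s (m∸n≤m D k))))
pal-ones D .vanish k D<k = below-≥ (suc D) (λ _ → 1) k D<k

window-0 : ∀ D b → window D b 0 ≡ b 0
window-0 zero    b = refl
window-0 (suc D) b = +-identityʳ (b 0)

-- consecutive window sums differ by the entering and the leaving coefficient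
window-step : ∀ D b k → window D b (suc k) + shiftBy D b k ≡ window D b k + b (suc k)
window-step zero    b k = +-comm (b (suc k)) (b k)
window-step (suc D) b zero = begin
    b 1 + window D b 0 + 0  ≡⟨ +-identityʳ _ ⟩
    b 1 + window D b 0      ≡⟨ cong (b 1 +_) (window-0 D b) ⟩
    b 1 + b 0               ≡⟨ +-comm (b 1) (b 0) ⟩
    b 0 + b 1               ≡⟨ cong (_+ b 1) (+-identityʳ (b 0)) ⟨
    b 0 + 0 + b 1           ∎
  where open ≡-Reasoning
window-step (suc D) b (suc k) = begin
    b (2 + k) + window D b (suc k) + shiftBy D b k    ≡⟨ +-assoc (b (2 + k)) _ _ ⟩
    b (2 + k) + (window D b (suc k) + shiftBy D b k)  ≡⟨ cong (b (2 + k) +_) (window-step D b k) ⟩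
    b (2 + k) + (window D b k + b (suc k))            ≡⟨ +-comm (b (2 + k)) _ ⟩
    window D b k + b (suc k) + b (2 + k)              ≡⟨ cong (_+ b (2 + k)) (+-comm (window D b k) _) ⟩
    b (suc k) + window D b k + b (2 + k)              ∎
  where open ≡-Reasoning

window-rising : ∀ D E {b} → PalUnimodal E b →
  ∀ k → suc (suc (k + k)) ≤ D + E → window D b k ≤ window D b (suc k)
window-rising D E {b} pb k h =
  +-cancelʳ-≤ (b (suc k)) (window D b k) (window D b (suc k))
    (subst (_≤ window D b (suc k) + b (suc k)) (window-step D b k)
           (+-monoʳ-≤ (window D b (suc k)) leaving≤entering))
  where
  leaving≤entering : shiftBy D b k ≤ b (suc k)
  leaving≤entering with k <? D
  ... | yes k<D = subst (_≤ b (suc k)) (sym (shiftBy-< D b k k<D)) z≤n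
  ... | no k≮D with m≤n⇒∃[o]m+o≡n (≮⇒≥ k≮D)
  ...   | t , refl = subst (_≤ b (suc (D + t))) (sym (shiftBy-≥ D b t))
                       (towards-centre pb t (suc (D + t)) (≤-trans (m≤n+m t D) (n≤1+n _)) t+1+D+t≤E)
    where
    rearrange : suc (suc ((D + t) + (D + t))) ≡ D + suc (suc (t + (D + t)))
    rearrange = trans (cong (suc ∘ suc) (+-assoc D t (D + t)))
                      (sym (trans (+-suc D _) (cong suc (+-suc D _))))
    t+1+D+t≤E : t + suc (D + t) ≤ E
    t+1+D+t≤E = subst (_≤ E) (sym (+-suc t (D + t)))
                  (≤-trans (n≤1+n _) (+-cancelˡ-≤ D _ _ (subst (_≤ D + E) rearrange h)))

pu-window : ∀ D E {b} → PalUnimodal E b → PalUnimodal (D + E) (window D b)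
pu-window D E pb .palindromic =
  pal-cong (mul-ones D _) (pal-mul D E (pal-ones D) (palindromic pb))
pu-window D E pb .rising = window-rising D E pb

tail : Poly → Poly
tail a k = a (suc k) ∸ a 0

pu-peel : ∀ D {a} → PalUnimodal D a → a ≗ scale (a 0) (ones D) ⊕ shift (tail a)
pu-peel D {a} pu zero = sym (begin
    a 0 * ones D 0 + 0           ≡⟨ +-identityʳ _ ⟩
    a 0 * 1                      ≡⟨ *-identityʳ (a 0) ⟩
    a 0                          ∎)
  where open ≡-Reasoning
pu-peel D {a} pu (suc k) with suc k ≤? D
... | yes k+1≤D = sym (begin
    a 0 * ones D (suc k) + (a (suc k) ∸ a 0)  ≡⟨ cong (λ o → a 0 * o + (a (suc k) ∸ a 0)) (below-< (suc D) (λ _ → 1) (suc k) (s≤s k+1≤D)) ⟩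
    a 0 * 1 + (a (suc k) ∸ a 0)               ≡⟨ cong (_+ (a (suc k) ∸ a 0)) (*-identityʳ (a 0)) ⟩
    a 0 + (a (suc k) ∸ a 0)                   ≡⟨ m+[n∸m]≡n (towards-centre pu 0 (suc k) z≤n k+1≤D) ⟩
    a (suc k)                                 ∎)
  where open ≡-Reasoning
... | no k+1≰D = sym (begin
    a 0 * ones D (suc k) + (a (suc k) ∸ a 0)  ≡⟨ cong₂ (λ o c → a 0 * o + (c ∸ a 0)) (below-≥ (suc D) (λ _ → 1) (suc k) D<k+1) (vanish (palindromic pu) (suc k) D<k+1) ⟩
    a 0 * 0 + (0 ∸ a 0)                       ≡⟨ cong₂ _+_ (*-zeroʳ (a 0)) (0∸n≡0 (a 0)) ⟩
    0                                         ≡⟨ vanish (palindromic pu) (suc k) D<k+1 ⟨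
    a (suc k)                                 ∎)
  where
  open ≡-Reasoning
  D<k+1 = ≰⇒> k+1≰D

pu-tail : ∀ D {a} → PalUnimodal (suc (suc D)) a → PalUnimodal D (tail a)
pu-tail D {a} pu .palindromic .mirror k k≤D =
  cong (_∸ a 0) (trans (mirror (palindromic pu) (suc k) (s≤s (m≤n⇒m≤1+n k≤D)))
                       (cong a (+-∸-assoc 1 k≤D)))
pu-tail D {a} pu .palindromic .vanish k D<k with m≤n⇒m<n∨m≡n D<k
... | inj₁ D+1<k = trans (cong (_∸ a 0) (vanish (palindromic pu) (suc k) (s≤s D+1<k))) (0∸n≡0 (a 0))
... | inj₂ refl  = trans (cong (_∸ a 0) (trans (mirror (palindromic pu) (suc (suc D)) ≤-refl)
                                              (cong a (n∸n≡0 (suc (suc D))))))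
                         (n∸n≡0 (a 0))
pu-tail D {a} pu .rising k h =
  ∸-monoˡ-≤ (a 0) (rising pu (suc k) (s≤s (s≤s (subst (_≤ D) (sym (cong suc (+-suc k k))) h))))

shift-mul-0p : ∀ {r} b → r ≗ 0p → shift (mul r b) ≗ 0p
shift-mul-0p b r≗0 zero    = refl
shift-mul-0p b r≗0 (suc k) = trans (mul-cong r≗0 (λ _ → refl) k) (mul-0pˡ b k)

pu-mul : ∀ D E {a b} → PalUnimodal D a → PalUnimodal E b → PalUnimodal (D + E) (mul a b)
pu-mul D E {a} {b} pa pb =
  pu-cong (≗-sym peeled) (pu-⊕ (pu-scale (a 0) (pu-window D E pb)) (tail-part D pa))
  where
  peeled : mul a b ≗ scale (a 0) (window D b) ⊕ shift (mul (tail a) b)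
  peeled = ≗-trans (mul-cong (pu-peel D pa) (λ _ → refl))
           (≗-trans (mul-split (a 0) (ones D) (tail a) b)
                    (⊕-cong (scale-cong (a 0) (mul-ones D b)) (λ _ → refl)))
  tail-part : ∀ D {a} → PalUnimodal D a → PalUnimodal (D + E) (shift (mul (tail a) b))
  tail-part zero {a} pa = pu-cong (≗-sym (shift-mul-0p b tail≗0)) pu-0p
    where
    tail≗0 : tail a ≗ 0p
    tail≗0 k = trans (cong (_∸ a 0) (vanish (palindromic pa) (suc k) (s≤s z≤n))) (0∸n≡0 (a 0))
  tail-part (suc zero) {a} pa = pu-cong (≗-sym (shift-mul-0p b tail≗0)) pu-0p
    where
    tail≗0 : tail a ≗ 0p
    tail≗0 zero    = trans (cong (_∸ a 0) (mirror (palindromic pa) 1 ≤-refl)) (n∸n≡0 (a 0))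
    tail≗0 (suc k) = trans (cong (_∸ a 0) (vanish (palindromic pa) (2 + k) (s≤s (s≤s z≤n)))) (0∸n≡0 (a 0))
  tail-part (suc (suc D)) pa = pu-shift (pu-mul D E (pu-tail D pa) pb)

record CentredClass (Φ : ℕ → Poly → Set) : Set₁ where
  field
    respects   : ∀ {D a b} → a ≗ b → Φ D a → Φ D b
    has-0p     : ∀ {D} → Φ D 0p
    has-1p     : Φ 0 1p
    closed-⊕   : ∀ {D a b} → Φ D a → Φ D b → Φ D (a ⊕ b)
    closed-x²  : ∀ {D a} → Φ D a → Φ (suc (suc D)) (shift a)
    closed-mul : ∀ {D E a b} → Φ D a → Φ E b → Φ (D + E) (mul a b)

palindromicClass : CentredClass Palindromic
palindromicClass = record
  { respects = pal-cong ; has-0p = pal-0p ; has-1p = pal-1p ; closed-⊕ = pal-⊕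
  ; closed-x² = pal-shift ; closed-mul = λ {D} {E} → pal-mul D E }

palUnimodalClass : CentredClass PalUnimodal
palUnimodalClass = record
  { respects = pu-cong ; has-0p = pu-0p ; has-1p = pu-1p ; closed-⊕ = pu-⊕
  ; closed-x² = pu-shift ; closed-mul = λ {D} {E} → pu-mul D E }

-- Sums over subsets:  subsetSum N F = Σ_{S ⊆ {0 … N-1}} x ^ |S| · F S.

subsetSum : (N : ℕ) → (Subset N → Poly) → Poly
subsetSum zero    F = F []
subsetSum (suc N) F = shift (subsetSum N (F ∘ (true ∷_))) ⊕ subsetSum N (F ∘ (false ∷_))

subsetSum-cong : ∀ N {F F′ : Subset N → Poly} → (∀ S → F S ≗ F′ S) → subsetSum N F ≗ subsetSum N F′
subsetSum-cong zero    e = e []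
subsetSum-cong (suc N) e = ⊕-cong (shift-cong (subsetSum-cong N (e ∘ (true ∷_))))
                                  (subsetSum-cong N (e ∘ (false ∷_)))

subsetSum-0p : ∀ N → subsetSum N (λ _ → 0p) ≗ 0p
subsetSum-0p zero    k = refl
subsetSum-0p (suc N) k = cong₂ _+_ (trans (shift-cong (subsetSum-0p N) k) (shift-0p k)) (subsetSum-0p N k)

subsetSum-at-0 : ∀ N (F : Subset N → Poly) → subsetSum N F 0 ≡ F (replicate N false) 0
subsetSum-at-0 zero    F = refl
subsetSum-at-0 (suc N) F = subsetSum-at-0 N (F ∘ (false ∷_))

subsetSum-++ : ∀ a b (F : Subset (a + b) → Poly) →
  subsetSum (a + b) F ≗ subsetSum a (λ S → subsetSum b (λ T → F (S ++ᵛ T)))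
subsetSum-++ zero    b F k = refl
subsetSum-++ (suc a) b F   = ⊕-cong (shift-cong (subsetSum-++ a b _)) (subsetSum-++ a b _)

subsetSum-mul : ∀ N (F : Subset N → Poly) R → subsetSum N (λ S → mul (F S) R) ≗ mul (subsetSum N F) R
subsetSum-mul zero    F R k = refl
subsetSum-mul (suc N) F R =
  ≗-trans (⊕-cong (shift-cong (subsetSum-mul N _ R)) (subsetSum-mul N _ R))
          (≗-sym (≗-trans (mul-⊕ˡ _ _ R) (⊕-cong (mul-shiftˡ _ R) (λ _ → refl))))

-- X · x ^ c is centred at D / 2 within Φ (or X vanishes)
CentredTerm : (ℕ → Poly → Set) → ℕ → ℕ → Poly → Set
CentredTerm Φ D c X = (X ≗ 0p) ⊎ (∃ λ E → E + (c + c) ≡ D × Φ E X)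

module _ {Φ : ℕ → Poly → Set} (class : CentredClass Φ) where
  open CentredClass class

  closed-shiftBy : ∀ j {E D X} → E + (j + j) ≡ D → Φ E X → Φ D (shiftBy j X)
  closed-shiftBy zero    {E} {X = X} refl φ = subst (λ d → Φ d X) (sym (+-identityʳ E)) φ
  closed-shiftBy (suc j) {E} {X = X} refl φ =
    subst (λ d → Φ d (shiftBy (suc j) X)) 2+E+2j≡E+2[1+j] (closed-x² (closed-shiftBy j {E} refl φ))
    where
    2+E+2j≡E+2[1+j] : suc (suc (E + (j + j))) ≡ E + (suc j + suc j)
    2+E+2j≡E+2[1+j] = solve 2 (λ E j → con 2 :+ (E :+ (j :+ j)) := E :+ ((con 1 :+ j) :+ (con 1 :+ j))) refl E j

  centred-subsetSum : ∀ N j D (F : Subset N → Poly) →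
    (∀ S → CentredTerm Φ D (j + ∣ S ∣) (F S)) → Φ D (shiftBy j (subsetSum N F))
  centred-subsetSum zero j D F terms with terms []
  ... | inj₁ F≗0           = respects (≗-sym (≗-trans (shiftBy-cong j F≗0) (shiftBy-0p j))) has-0p
  ... | inj₂ (E , deg , φ) = closed-shiftBy j (subst (λ c → E + (c + c) ≡ D) (+-identityʳ j) deg) φ
  centred-subsetSum (suc N) j D F terms =
    respects (≗-sym (≗-trans (shiftBy-⊕ j _ _) (⊕-cong (shiftBy-shift j _) (λ _ → refl))))
      (closed-⊕ (centred-subsetSum N (suc j) D (F ∘ (true ∷_)) withFirst)
                (centred-subsetSum N j D (F ∘ (false ∷_)) (terms ∘ (false ∷_))))
    where
    withFirst : ∀ S → CentredTerm Φ D (suc j + ∣ S ∣) (F (true ∷ S))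
    withFirst S = subst (λ c → CentredTerm Φ D c (F (true ∷ S))) (+-suc j ∣ S ∣) (terms (true ∷ S))

bit : Bool → ℕ
bit true  = 1
bit false = 0

indicator : Bool → Poly
indicator true  = 1p
indicator false = 0p

countᵇ : ∀ {A : Set} → (A → Bool) → List A → ℕ
countᵇ p []       = 0
countᵇ p (x ∷ xs) = bit (p x) + countᵇ p xs

countᵇ-++ : ∀ {A : Set} (p : A → Bool) xs ys → countᵇ p (xs ++ˡ ys) ≡ countᵇ p xs + countᵇ p ys
countᵇ-++ p []       ys = refl
countᵇ-++ p (x ∷ xs) ys = trans (cong (bit (p x) +_) (countᵇ-++ p xs ys)) (sym (+-assoc (bit (p x)) _ _))

countᵇ-map : ∀ {A B : Set} (p : B → Bool) (f : A → B) xs → countᵇ p (map f xs) ≡ countᵇ (p ∘ f) xs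
countᵇ-map p f []       = refl
countᵇ-map p f (x ∷ xs) = cong (bit (p (f x)) +_) (countᵇ-map p f xs)

countᵇ-cong : ∀ {A : Set} {p p′ : A → Bool} → (∀ x → p x ≡ p′ x) → ∀ xs → countᵇ p xs ≡ countᵇ p′ xs
countᵇ-cong e []       = refl
countᵇ-cong e (x ∷ xs) = cong₂ _+_ (cong bit (e x)) (countᵇ-cong e xs)

countᵇ-false : ∀ {A : Set} (xs : List A) → countᵇ (λ _ → false) xs ≡ 0
countᵇ-false []       = refl
countᵇ-false (x ∷ xs) = countᵇ-false xs

-- Defs counts by filtering twice; this turns the double filter into one count
length-filter-filter : ∀ {A : Set} {ℓ ℓ′} {P : Pred A ℓ} {Q : Pred A ℓ′} (P? : Decidable P) (Q? : Decidable Q) xs →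
  length (filter P? (filter Q? xs)) ≡ countᵇ (λ x → does (Q? x) ∧ does (P? x)) xs
length-filter-filter P? Q? [] = refl
length-filter-filter P? Q? (x ∷ xs) with does (Q? x)
... | false = length-filter-filter P? Q? xs
... | true with does (P? x)
...   | false = length-filter-filter P? Q? xs
...   | true  = cong suc (length-filter-filter P? Q? xs)

count-subsets : ∀ N (p : Subset N → Bool) k →
  countᵇ (λ S → p S ∧ (∣ S ∣ ≡ᵇ k)) (allSubsets N) ≡ subsetSum N (indicator ∘ p) k
count-subsets zero p k with p []
... | false = refl
count-subsets zero p zero    | true = refl
count-subsets zero p (suc k) | true = refl
count-subsets (suc N) p k = begin
    countᵇ test (map (true ∷_) (allSubsets N) ++ˡ map (false ∷_) (allSubsets N))
  ≡⟨ countᵇ-++ test (map (true ∷_) (allSubsets N)) _ ⟩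
    countᵇ test (map (true ∷_) (allSubsets N)) + countᵇ test (map (false ∷_) (allSubsets N))
  ≡⟨ cong₂ _+_ (trans (countᵇ-map test (true ∷_) (allSubsets N)) (with-first k))
               (trans (countᵇ-map test (false ∷_) (allSubsets N)) (count-subsets N (p ∘ (false ∷_)) k)) ⟩
    subsetSum (suc N) (indicator ∘ p) k
  ∎
  where
  open ≡-Reasoning
  test = λ S → p S ∧ (∣ S ∣ ≡ᵇ k)
  with-first : ∀ k → countᵇ (λ S → p (true ∷ S) ∧ (suc ∣ S ∣ ≡ᵇ k)) (allSubsets N)
                   ≡ shift (subsetSum N (indicator ∘ p ∘ (true ∷_))) k
  with-first zero    = trans (countᵇ-cong (λ S → ∧-zeroʳ (p (true ∷ S))) (allSubsets N)) (countᵇ-false (allSubsets N))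
  with-first (suc k) = count-subsets N (p ∘ (true ∷_)) k

does-≟-true : ∀ b → does (b Bool.≟ true) ≡ b
does-≟-true true  = refl
does-≟-true false = refl

indepCount-subsetSum : ∀ {N} (adj : Fin N → Fin N → Bool) W k →
  indepCount adj W k ≡ subsetSum N (λ S → indicator (subsetᵇ S W ∧ independentᵇ adj S)) k
indepCount-subsetSum {N} adj W k =
  trans (length-filter-filter _ _ (allSubsets N))
  (trans (countᵇ-cong (λ S → cong (_∧ (∣ S ∣ ≡ᵇ k)) (does-≟-true (subsetᵇ S W ∧ independentᵇ adj S))) (allSubsets N))
         (count-subsets N _ k))

-- The independence number is the largest size of a listed independent set.
-- On indepSets, sizeCount is indepCount and largest is indepNum.

sizeCount : ∀ {N} → List (Subset N) → ℕ → ℕ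
sizeCount xs k = length (filter (λ S → ∣ S ∣ ≟ k) xs)

largest : ∀ {N} → List (Subset N) → ℕ
largest = foldr (λ S m → ∣ S ∣ ⊔ m) 0

sizeCount-∷ : ∀ {N} (x : Subset N) xs k → sizeCount (x ∷ xs) k ≡ bit (∣ x ∣ ≡ᵇ k) + sizeCount xs k
sizeCount-∷ x xs k with ∣ x ∣ ≡ᵇ k
... | true  = refl
... | false = refl

bit-≡ᵇ-≢ : ∀ m n → m ≢ n → bit (m ≡ᵇ n) ≡ 0
bit-≡ᵇ-≢ m n m≢n with m ≡ᵇ n in eq
... | false = refl
... | true  = ⊥-elim (m≢n (≡ᵇ⇒≡ m n (subst T (sym eq) _)))

bit-≡ᵇ-refl : ∀ n → bit (n ≡ᵇ n) ≡ 1
bit-≡ᵇ-refl zero    = refl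
bit-≡ᵇ-refl (suc n) = bit-≡ᵇ-refl n

sizeCount-beyond : ∀ {N} (xs : List (Subset N)) k → largest xs < k → sizeCount xs k ≡ 0
sizeCount-beyond []       k _ = refl
sizeCount-beyond (x ∷ xs) k largest<k = begin
    sizeCount (x ∷ xs) k                 ≡⟨ sizeCount-∷ x xs k ⟩
    bit (∣ x ∣ ≡ᵇ k) + sizeCount xs k    ≡⟨ cong₂ _+_ (bit-≡ᵇ-≢ ∣ x ∣ k (<⇒≢ ∣x∣<k)) (sizeCount-beyond xs k rest<k) ⟩
    0                                    ∎
  where
  open ≡-Reasoning
  ∣x∣<k   = ≤-<-trans (m≤m⊔n ∣ x ∣ (largest xs)) largest<k
  rest<k  = ≤-<-trans (m≤n⊔m ∣ x ∣ (largest xs)) largest<k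

sizeCount-below : ∀ {N} (xs : List (Subset N)) k → sizeCount xs k ≢ 0 → k ≤ largest xs
sizeCount-below []       k count≢0 = ⊥-elim (count≢0 refl)
sizeCount-below (x ∷ xs) k count≢0 with ∣ x ∣ ≟ k
... | yes refl = m≤m⊔n ∣ x ∣ (largest xs)
... | no ∣x∣≢k = ≤-trans (sizeCount-below xs k rest≢0) (m≤n⊔m ∣ x ∣ (largest xs))
  where
  rest≢0 : sizeCount xs k ≢ 0
  rest≢0 rest≡0 = count≢0 (trans (sizeCount-∷ x xs k) (cong₂ _+_ (bit-≡ᵇ-≢ ∣ x ∣ k ∣x∣≢k) rest≡0))

largest-≤ : ∀ {N} (xs : List (Subset N)) D → (∀ k → D < k → sizeCount xs k ≡ 0) → largest xs ≤ D
largest-≤ []       D _        = z≤n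
largest-≤ (x ∷ xs) D vanishes = ⊔-lub ∣x∣≤D (largest-≤ xs D (λ k D<k → m+n≡0⇒n≡0 _ (count≡0 k D<k)))
  where
  count≡0 : ∀ k → D < k → bit (∣ x ∣ ≡ᵇ k) + sizeCount xs k ≡ 0
  count≡0 k D<k = trans (sym (sizeCount-∷ x xs k)) (vanishes k D<k)
  ∣x∣≤D : ∣ x ∣ ≤ D
  ∣x∣≤D with ∣ x ∣ ≤? D
  ... | yes ∣x∣≤D = ∣x∣≤D
  ... | no ∣x∣≰D  = ⊥-elim (1+n≢0 (trans (cong (_+ sizeCount xs ∣ x ∣) (sym (bit-≡ᵇ-refl ∣ x ∣))) (count≡0 ∣ x ∣ (≰⇒> ∣x∣≰D))))

indepNum-unique : ∀ {N} (adj : Fin N → Fin N → Bool) W D →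
  (∀ k → D < k → indepCount adj W k ≡ 0) → indepCount adj W D ≢ 0 → indepNum adj W ≡ D
indepNum-unique adj W D vanishes top≢0 =
  ≤-antisym (largest-≤ (indepSets adj W) D vanishes) (sizeCount-below (indepSets adj W) D top≢0)

Independent : ∀ {N} → (Fin N → Fin N → Bool) → Subset N → Set
Independent adj S = ∀ u v → lookup S u ≡ true → lookup S v ≡ true → adj u v ≡ false

allᵇ-sound : ∀ {A : Set} (p : A → Bool) xs → allᵇ p xs ≡ true → ∀ {x} → x ∈ xs → p x ≡ true
allᵇ-sound p (y ∷ ys) all≡true (here refl)  = ∧-conicalˡ (p y) _ all≡true
allᵇ-sound p (y ∷ ys) all≡true (there x∈ys) = allᵇ-sound p ys (∧-conicalʳ (p y) _ all≡true) x∈ys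

allᵇ-complete : ∀ {A : Set} (p : A → Bool) xs → (∀ x → p x ≡ true) → allᵇ p xs ≡ true
allᵇ-complete p []       _   = refl
allᵇ-complete p (x ∷ xs) all rewrite all x = allᵇ-complete p xs all

not≡true : ∀ {b} → not b ≡ true → b ≡ false
not≡true {false} _ = refl

∧-intro : ∀ {x y} → x ≡ true → y ≡ true → x ∧ y ≡ true
∧-intro refl refl = refl

boolean-iff : ∀ {x y} → (x ≡ true → y ≡ true) → (y ≡ true → x ≡ true) → x ≡ y
boolean-iff {true}  {true}  _   _   = refl
boolean-iff {true}  {false} x⇒y _   = sym (x⇒y refl)
boolean-iff {false} {true}  _   y⇒x = y⇒x refl
boolean-iff {false} {false} _   _   = refl

independentᵇ-sound : ∀ {N} (adj : Fin N → Fin N → Bool) S → independentᵇ adj S ≡ true → Independent adj S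
independentᵇ-sound {N} adj S indep u v u∈S v∈S =
  edgeless (allᵇ-sound _ (allFin N) (allᵇ-sound _ (allFin N) indep (∈-allFin u)) (∈-allFin v))
  where
  edgeless : not (lookup S u ∧ lookup S v ∧ adj u v) ≡ true → adj u v ≡ false
  edgeless h rewrite u∈S | v∈S = not≡true h

independentᵇ-complete : ∀ {N} (adj : Fin N → Fin N → Bool) S → Independent adj S → independentᵇ adj S ≡ true
independentᵇ-complete {N} adj S indep =
  allᵇ-complete _ (allFin N) (λ u → allᵇ-complete _ (allFin N) (edgeless u))
  where
  edgeless : ∀ u v → not (lookup S u ∧ lookup S v ∧ adj u v) ≡ true
  edgeless u v with lookup S u in u∈S | lookup S v in v∈S
  ... | false | _     = refl
  ... | true  | false = refl
  ... | true  | true  rewrite indep u v u∈S v∈S = refl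

subsetᵇ-sound : ∀ {N} (S W : Subset N) → subsetᵇ S W ≡ true → ∀ i → lookup S i ≡ true → lookup W i ≡ true
subsetᵇ-sound (true ∷ S) (true ∷ W) _   Fin.zero    _    = refl
subsetᵇ-sound (s ∷ S)    (w ∷ W)    S⊆W (Fin.suc i) i∈S = subsetᵇ-sound S W (∧-conicalʳ (not s ∨ w) _ S⊆W) i i∈S

subsetᵇ-complete : ∀ {N} (S W : Subset N) → (∀ i → lookup S i ≡ true → lookup W i ≡ true) → subsetᵇ S W ≡ true
subsetᵇ-complete []      []      _   = refl
subsetᵇ-complete (s ∷ S) (w ∷ W) S⊆W =
  ∧-intro (head s w (S⊆W Fin.zero)) (subsetᵇ-complete S W (S⊆W ∘ Fin.suc))
  where
  head : ∀ s w → (s ≡ true → w ≡ true) → not s ∨ w ≡ true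
  head false w _   = refl
  head true  w s⇒w = s⇒w refl

subsetᵇ-⊤ : ∀ {N} (S : Subset N) → subsetᵇ S ⊤ ≡ true
subsetᵇ-⊤ S = subsetᵇ-complete S ⊤ (λ i _ → lookup-replicate i true)

-- the empty set is the unique independent set of size 0, so i₀ = 1
indepCount-0 : ∀ {N} (adj : Fin N → Fin N → Bool) W → indepCount adj W 0 ≡ 1
indepCount-0 {N} adj W = begin
    indepCount adj W 0
  ≡⟨ indepCount-subsetSum adj W 0 ⟩
    subsetSum N (λ S → indicator (subsetᵇ S W ∧ independentᵇ adj S)) 0
  ≡⟨ subsetSum-at-0 N _ ⟩
    indicator (subsetᵇ ∅ W ∧ independentᵇ adj ∅) 0
  ≡⟨ cong (λ b → indicator (b ∧ independentᵇ adj ∅) 0) (subsetᵇ-complete ∅ W (λ i i∈∅ → ⊥-elim (∉∅ i i∈∅))) ⟩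
    indicator (independentᵇ adj ∅) 0
  ≡⟨ cong (λ b → indicator b 0) (independentᵇ-complete adj ∅ (λ u _ u∈∅ → ⊥-elim (∉∅ u u∈∅))) ⟩
    1
  ∎
  where
  open ≡-Reasoning
  ∅ = replicate N false
  ∉∅ : ∀ i → lookup ∅ i ≢ true
  ∉∅ i i∈∅ with () ← trans (sym (lookup-replicate i false)) i∈∅

sum-zero : ∀ {r} {f : Fin r → ℕ} → (∀ i → f i ≡ 0) → sum f ≡ 0
sum-zero {r} f≗0 = trans (sum-cong-≗ f≗0) (sum-replicate-zero r)

size-as-sum : ∀ {N} (S : Subset N) → ∣ S ∣ ≡ sum (bit ∘ lookup S)
size-as-sum []          = refl
size-as-sum (true ∷ S)  = cong suc (size-as-sum S)
size-as-sum (false ∷ S) = size-as-sum S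

eqF-sound : ∀ {k} (i j : Fin k) → eqFᵇ i j ≡ true → i ≡ j
eqF-sound i j e with i ≟F j
... | yes i≡j = i≡j

eqF-refl : ∀ {k} (i : Fin k) → eqFᵇ i i ≡ true
eqF-refl i with i ≟F i
... | yes _  = refl
... | no i≢i = ⊥-elim (i≢i refl)

eqF-suc : ∀ {k} (i j : Fin k) → eqFᵇ (Fin.suc i) (Fin.suc j) ≡ eqFᵇ i j
eqF-suc i j with i ≟F j
... | yes _ = refl
... | no _  = refl

sum-point : ∀ r (c : Fin r) s → sum (λ C → bit (eqFᵇ c C ∧ s)) ≡ bit s
sum-point r c false = sum-zero (λ C → cong bit (∧-zeroʳ (eqFᵇ c C)))
sum-point r c true  = trans (sum-cong-≗ (λ C → cong bit (∧-identityʳ (eqFᵇ c C)))) (point r c)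
  where
  point : ∀ r (c : Fin r) → sum (λ C → bit (eqFᵇ c C)) ≡ 1
  point (suc r) Fin.zero    = cong suc (sum-zero {r} (λ _ → refl))
  point (suc r) (Fin.suc c) = trans (sum-cong-≗ (λ C → cong bit (eqF-suc c C))) (point r c)

anyᶠ : ∀ {N} → (Fin N → Bool) → Bool
anyᶠ {zero}  f = false
anyᶠ {suc N} f = f Fin.zero ∨ anyᶠ (f ∘ Fin.suc)

anyᶠ-sound : ∀ {N} (f : Fin N → Bool) → anyᶠ f ≡ true → ∃ λ i → f i ≡ true
anyᶠ-sound {suc N} f any≡true with f Fin.zero in f0
... | true  = Fin.zero , f0
... | false with anyᶠ-sound (f ∘ Fin.suc) any≡true
...   | i , fi = Fin.suc i , fi

anyᶠ-complete : ∀ {N} (f : Fin N → Bool) i → f i ≡ true → anyᶠ f ≡ true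
anyᶠ-complete {suc N} f Fin.zero    fi rewrite fi = refl
anyᶠ-complete {suc N} f (Fin.suc i) fi rewrite anyᶠ-complete (f ∘ Fin.suc) i fi = ∨-zeroʳ (f Fin.zero)

sum-at-most-one : ∀ N (f : Fin N → Bool) → (∀ i j → f i ≡ true → f j ≡ true → i ≡ j) →
  sum (bit ∘ f) ≡ bit (anyᶠ f)
sum-at-most-one zero    f _      = refl
sum-at-most-one (suc N) f unique with f Fin.zero in f0
... | true  = cong suc (sum-zero others)
  where
  others : ∀ i → bit (f (Fin.suc i)) ≡ 0
  others i with f (Fin.suc i) in fi
  ... | false = refl
  ... | true with () ← unique Fin.zero (Fin.suc i) f0 fi
... | false = sum-at-most-one N (f ∘ Fin.suc) (λ i j fi fj → Fin-suc-injective (unique _ _ fi fj))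

blocks : ∀ {A : Set} r m → Vec A (r * m) → Vec (Vec A m) r
blocks zero    m _ = []
blocks (suc r) m S = take m S ∷ blocks r m (drop m S)

concat-blocks : ∀ {A : Set} r m (S : Vec A (r * m)) → concat (blocks r m S) ≡ S
concat-blocks zero    m [] = refl
concat-blocks (suc r) m S  = trans (cong (take m S ++ᵛ_) (concat-blocks r m (drop m S))) (take++drop≡id m S)

lookup-blocks : ∀ {A : Set} r m (S : Vec A (r * m)) C h →
  lookup S (Fin.combine C h) ≡ lookup (lookup (blocks r m S) C) h
lookup-blocks r m S C h =
  trans (cong (λ v → lookup v (Fin.combine C h)) (sym (concat-blocks r m S))) (lookup-concat (blocks r m S) C h)

take-++ : ∀ {A : Set} m {k} (T : Vec A m) (S : Vec A k) → take m (T ++ᵛ S) ≡ T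
take-++ m T S = ++-injectiveˡ (take m (T ++ᵛ S)) T (take++drop≡id m (T ++ᵛ S))

drop-++ : ∀ {A : Set} m {k} (T : Vec A m) (S : Vec A k) → drop m (T ++ᵛ S) ≡ S
drop-++ m T S = ++-injectiveʳ (take m (T ++ᵛ S)) T (take++drop≡id m (T ++ᵛ S))

-- A vertex set
-- S₁ ++ S₂ (S₁ ⊆ V(G), and S₂ made of one block T_C ⊆ V(H) per clique C)
-- is independent iff S₁ is independent in G and every T_C is independent
-- in H, avoiding U when S₁ meets C.

module ProductGraph {n m q : ℕ} (G : Graph n) (H : Graph m) (𝒞 : CliqueCover G q) (U : Subset m) where

  M : ℕ
  M = q * m

  P : Fin (n + M) → Fin (n + M) → Bool
  P = productAdj G 𝒞 H U

  -- the vertices of H a block may use: H - U when S₁ meets its clique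
  allowed : Bool → Subset m
  allowed true  = ∁ U
  allowed false = ⊤

  blockOK : Bool → Subset m → Bool
  blockOK meets T = subsetᵇ T (allowed meets) ∧ independentᵇ (adj H) T

  blocksOK : ∀ r → (Fin r → Bool) → Subset (r * m) → Bool
  blocksOK zero    _     _ = true
  blocksOK (suc r) meets S = blockOK (meets Fin.zero) (take m S) ∧ blocksOK r (meets ∘ Fin.suc) (drop m S)

  blocksOK-sound : ∀ r meets S → blocksOK r meets S ≡ true →
    ∀ C → blockOK (meets C) (lookup (blocks r m S) C) ≡ true
  blocksOK-sound (suc r) meets S ok Fin.zero    = ∧-conicalˡ _ _ ok
  blocksOK-sound (suc r) meets S ok (Fin.suc C) =
    blocksOK-sound r (meets ∘ Fin.suc) (drop m S) (∧-conicalʳ (blockOK (meets Fin.zero) (take m S)) _ ok) C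

  blocksOK-complete : ∀ r meets S → (∀ C → blockOK (meets C) (lookup (blocks r m S) C) ≡ true) →
    blocksOK r meets S ≡ true
  blocksOK-complete zero    meets S _  = refl
  blocksOK-complete (suc r) meets S ok =
    ∧-intro (ok Fin.zero) (blocksOK-complete r (meets ∘ Fin.suc) (drop m S) (ok ∘ Fin.suc))

  meets : Subset n → Fin q → Bool
  meets S₁ C = anyᶠ (λ g → eqFᵇ (cls 𝒞 g) C ∧ lookup S₁ g)

  data Vertex : Fin (n + M) → Set where
    base : ∀ g → Vertex (g ↑ˡ M)
    copy : ∀ (C : Fin q) (h : Fin m) → Vertex (n ↑ʳ Fin.combine C h)

  vertex : ∀ u → Vertex u
  vertex u with Fin.splitAt n u in split
  ... | inj₁ g rewrite sym (splitAt⁻¹-↑ˡ split) = base g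
  ... | inj₂ w rewrite sym (splitAt⁻¹-↑ʳ split) | sym (combine-remQuot {q} m w) =
    copy (proj₁ (Fin.remQuot {q} m w)) (proj₂ (Fin.remQuot {q} m w))

  adj-base-base : ∀ g g′ → P (g ↑ˡ M) (g′ ↑ˡ M) ≡ adj G g g′
  adj-base-base g g′ rewrite splitAt-↑ˡ n g M | splitAt-↑ˡ n g′ M = refl

  adj-base-copy : ∀ g C h → P (g ↑ˡ M) (n ↑ʳ Fin.combine C h) ≡ eqFᵇ (cls 𝒞 g) C ∧ lookup U h
  adj-base-copy g C h rewrite splitAt-↑ˡ n g M | splitAt-↑ʳ n M (Fin.combine C h) =
    cong (λ (C , h) → eqFᵇ (cls 𝒞 g) C ∧ lookup U h) (remQuot-combine {q} {m} C h)

  adj-copy-base : ∀ g C h → P (n ↑ʳ Fin.combine C h) (g ↑ˡ M) ≡ eqFᵇ (cls 𝒞 g) C ∧ lookup U h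
  adj-copy-base g C h rewrite splitAt-↑ˡ n g M | splitAt-↑ʳ n M (Fin.combine C h) =
    cong (λ (C , h) → eqFᵇ (cls 𝒞 g) C ∧ lookup U h) (remQuot-combine {q} {m} C h)

  adj-copy-copy : ∀ (C : Fin q) h (C′ : Fin q) h′ →
    P (n ↑ʳ Fin.combine C h) (n ↑ʳ Fin.combine C′ h′) ≡ eqFᵇ C C′ ∧ adj H h h′
  adj-copy-copy C h C′ h′ rewrite splitAt-↑ʳ n M (Fin.combine C h) | splitAt-↑ʳ n M (Fin.combine C′ h′) =
    cong₂ (λ (C , h) (C′ , h′) → eqFᵇ C C′ ∧ adj H h h′)
          (remQuot-combine {q} {m} C h) (remQuot-combine {q} {m} C′ h′)

  lookup-∁ : ∀ h → lookup (∁ U) h ≡ not (lookup U h)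
  lookup-∁ h = lookup-map h not U

  module _ (S₁ : Subset n) (S₂ : Subset M) where

    block : Fin q → Subset m
    block C = lookup (blocks q m S₂) C

    lookup-base : ∀ g → lookup (S₁ ++ᵛ S₂) (g ↑ˡ M) ≡ lookup S₁ g
    lookup-base g = lookup-++ˡ S₁ S₂ g

    lookup-copy : ∀ C h → lookup (S₁ ++ᵛ S₂) (n ↑ʳ Fin.combine C h) ≡ lookup (block C) h
    lookup-copy C h = trans (lookup-++ʳ S₁ S₂ _) (lookup-blocks q m S₂ C h)

    BlocksOK : Set
    BlocksOK = ∀ C → blockOK (meets S₁ C) (block C) ≡ true

    independent-parts : Independent P (S₁ ++ᵛ S₂) → Independent (adj G) S₁ × BlocksOK
    independent-parts indep =
      indepG , λ C → ∧-intro (inAllowed C) (independentᵇ-complete (adj H) (block C) (indepBlock C))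
      where
      indepG : Independent (adj G) S₁
      indepG g g′ g∈ g′∈ = trans (sym (adj-base-base g g′))
        (indep _ _ (trans (lookup-base g) g∈) (trans (lookup-base g′) g′∈))
      indepBlock : ∀ C → Independent (adj H) (block C)
      indepBlock C h h′ h∈ h′∈ = trans (sym (trans (adj-copy-copy C h C h′) (cong (_∧ adj H h h′) (eqF-refl C))))
        (indep _ _ (trans (lookup-copy C h) h∈) (trans (lookup-copy C h′) h′∈))
      -- a block whose clique is met by S₁ is joined to that vertex, so avoids U
      inAllowed : ∀ C → subsetᵇ (block C) (allowed (meets S₁ C)) ≡ true
      inAllowed C with meets S₁ C in met
      ... | false = subsetᵇ-⊤ (block C)
      ... | true with anyᶠ-sound _ met
      ...   | g , g∈C∩S₁ = subsetᵇ-complete (block C) (∁ U) avoidsU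
        where
        avoidsU : ∀ h → lookup (block C) h ≡ true → lookup (∁ U) h ≡ true
        avoidsU h h∈ = trans (lookup-∁ h) (cong not h∉U)
          where
          edge : eqFᵇ (cls 𝒞 g) C ∧ lookup U h ≡ false
          edge = trans (sym (adj-base-copy g C h))
            (indep _ _ (trans (lookup-base g) (∧-conicalʳ _ _ g∈C∩S₁)) (trans (lookup-copy C h) h∈))
          h∉U : lookup U h ≡ false
          h∉U = trans (sym (cong (_∧ lookup U h) (∧-conicalˡ _ _ g∈C∩S₁))) edge

    -- a vertex g ∈ S₁ of clique C forces the block at C into H - U
    base-copy-edgeless : BlocksOK → ∀ g C h → lookup S₁ g ≡ true → lookup (block C) h ≡ true →
      eqFᵇ (cls 𝒞 g) C ∧ lookup U h ≡ false
    base-copy-edgeless ok g C h g∈ h∈ with eqFᵇ (cls 𝒞 g) C in g∈C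
    ... | false = refl
    ... | true  = not≡true (trans (sym (lookup-∁ h)) (subsetᵇ-sound (block C) (∁ U) inH-U h h∈))
      where
      inH-U : subsetᵇ (block C) (∁ U) ≡ true
      inH-U = subst (λ b → subsetᵇ (block C) (allowed b) ≡ true)
                    (anyᶠ-complete _ g (∧-intro g∈C g∈))
                    (∧-conicalˡ _ _ (ok C))

    copy-copy-edgeless : BlocksOK → ∀ C h C′ h′ → lookup (block C) h ≡ true → lookup (block C′) h′ ≡ true →
      eqFᵇ C C′ ∧ adj H h h′ ≡ false
    copy-copy-edgeless ok C h C′ h′ h∈ h′∈ with eqFᵇ C C′ in C≡C′
    ... | false = refl
    ... | true with eqF-sound C C′ C≡C′
    ...   | refl = independentᵇ-sound (adj H) (block C) (∧-conicalʳ _ _ (ok C)) h h′ h∈ h′∈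

    independent-from-parts : Independent (adj G) S₁ → BlocksOK → Independent P (S₁ ++ᵛ S₂)
    independent-from-parts indepG ok u v u∈ v∈ with vertex u | vertex v
    ... | base g   | base g′    = trans (adj-base-base g g′)
      (indepG g g′ (trans (sym (lookup-base g)) u∈) (trans (sym (lookup-base g′)) v∈))
    ... | base g   | copy C h   = trans (adj-base-copy g C h)
      (base-copy-edgeless ok g C h (trans (sym (lookup-base g)) u∈) (trans (sym (lookup-copy C h)) v∈))
    ... | copy C h | base g     = trans (adj-copy-base g C h)
      (base-copy-edgeless ok g C h (trans (sym (lookup-base g)) v∈) (trans (sym (lookup-copy C h)) u∈))
    ... | copy C h | copy C′ h′ = trans (adj-copy-copy C h C′ h′)
      (copy-copy-edgeless ok C h C′ h′ (trans (sym (lookup-copy C h)) u∈) (trans (sym (lookup-copy C′ h′)) v∈))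

    independentᵇ-product : independentᵇ P (S₁ ++ᵛ S₂) ≡ independentᵇ (adj G) S₁ ∧ blocksOK q (meets S₁) S₂
    independentᵇ-product = boolean-iff
      (λ indep → let indepG , parts = independent-parts (independentᵇ-sound P (S₁ ++ᵛ S₂) indep) in
        ∧-intro (independentᵇ-complete (adj G) S₁ indepG) (blocksOK-complete q (meets S₁) S₂ parts))
      (λ both → independentᵇ-complete P (S₁ ++ᵛ S₂) (independent-from-parts
        (independentᵇ-sound (adj G) S₁ (∧-conicalˡ _ _ both))
        (blocksOK-sound q (meets S₁) S₂ (∧-conicalʳ (independentᵇ (adj G) S₁) _ both))))

  blockPoly : Bool → Poly
  blockPoly meets = subsetSum m (indicator ∘ blockOK meets)

  blocksPoly : ∀ r → (Fin r → Bool) → Poly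
  blocksPoly zero    _     = 1p
  blocksPoly (suc r) meets = mul (blockPoly (meets Fin.zero)) (blocksPoly r (meets ∘ Fin.suc))

  subsetSum-guard : ∀ N x (r : Subset N → Bool) →
    subsetSum N (λ S → indicator (x ∧ r S)) ≗ mul (indicator x) (subsetSum N (indicator ∘ r))
  subsetSum-guard N true  r k = sym (mul-1pˡ _ k)
  subsetSum-guard N false r k = trans (subsetSum-0p N k) (sym (mul-0pˡ _ k))

  subsetSum-blocks : ∀ r meets → subsetSum (r * m) (indicator ∘ blocksOK r meets) ≗ blocksPoly r meets
  subsetSum-blocks zero    meets k = refl
  subsetSum-blocks (suc r) meets =
    ≗-trans (subsetSum-++ m (r * m) _)
    (≗-trans (subsetSum-cong m (λ T → ≗-trans (subsetSum-cong (r * m) (split T))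
                                              (subsetSum-guard (r * m) (blockOK (meets Fin.zero) T) _)))
    (≗-trans (subsetSum-mul m (indicator ∘ blockOK (meets Fin.zero)) _)
             (mul-cong (λ _ → refl) (subsetSum-blocks r (meets ∘ Fin.suc)))))
    where
    split : ∀ T S → indicator (blocksOK (suc r) meets (T ++ᵛ S))
                  ≗ indicator (blockOK (meets Fin.zero) T ∧ blocksOK r (meets ∘ Fin.suc) S)
    split T S k = cong₂ (λ T′ S′ → indicator (blockOK (meets Fin.zero) T′ ∧ blocksOK r (meets ∘ Fin.suc) S′) k)
                        (take-++ m T S) (drop-++ m T S)

  term : Subset n → Poly
  term S₁ = if independentᵇ (adj G) S₁ then blocksPoly q (meets S₁) else 0p

  indepCount-product : ∀ k → indepCount P ⊤ k ≡ subsetSum n term k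
  indepCount-product k =
    trans (indepCount-subsetSum P ⊤ k)
    (trans (subsetSum-++ n M _ k)
           (subsetSum-cong n (λ S₁ → ≗-trans (subsetSum-cong M (extend S₁)) (byCase S₁ (independentᵇ (adj G) S₁))) k))
    where
    extend : ∀ S₁ S₂ → indicator (subsetᵇ (S₁ ++ᵛ S₂) ⊤ ∧ independentᵇ P (S₁ ++ᵛ S₂))
                     ≗ indicator (independentᵇ (adj G) S₁ ∧ blocksOK q (meets S₁) S₂)
    extend S₁ S₂ k = cong (λ b → indicator b k)
      (trans (cong (_∧ independentᵇ P (S₁ ++ᵛ S₂)) (subsetᵇ-⊤ (S₁ ++ᵛ S₂))) (independentᵇ-product S₁ S₂))
    byCase : ∀ S₁ b → subsetSum M (λ S₂ → indicator (b ∧ blocksOK q (meets S₁) S₂))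
                      ≗ (if b then blocksPoly q (meets S₁) else 0p)
    byCase S₁ true  = subsetSum-blocks q (meets S₁)
    byCase S₁ false = subsetSum-0p M

  -- an independent S₁ has at most one vertex per clique, so |S₁| counts the cliques it meets
  size-meets : ∀ S₁ → Independent (adj G) S₁ → ∣ S₁ ∣ ≡ sum (bit ∘ meets S₁)
  size-meets S₁ indep = begin
      ∣ S₁ ∣
    ≡⟨ size-as-sum S₁ ⟩
      sum (λ v → bit (lookup S₁ v))
    ≡⟨ sum-cong-≗ (λ v → sum-point q (cls 𝒞 v) (lookup S₁ v)) ⟨
      sum (λ v → sum (λ C → bit (eqFᵇ (cls 𝒞 v) C ∧ lookup S₁ v)))
    ≡⟨ ∑-comm {n} {q} (λ v C → bit (eqFᵇ (cls 𝒞 v) C ∧ lookup S₁ v)) ⟩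
      sum (λ C → sum (λ v → bit (eqFᵇ (cls 𝒞 v) C ∧ lookup S₁ v)))
    ≡⟨ sum-cong-≗ (λ C → sum-at-most-one n _ (oneInClique C)) ⟩
      sum (bit ∘ meets S₁)
    ∎
    where
    open ≡-Reasoning
    oneInClique : ∀ C u v → eqFᵇ (cls 𝒞 u) C ∧ lookup S₁ u ≡ true → eqFᵇ (cls 𝒞 v) C ∧ lookup S₁ v ≡ true → u ≡ v
    oneInClique C u v u∈ v∈ = decidable-stable (u ≟F v) (λ u≢v → true≢false (begin
        true       ≡⟨ clique 𝒞 u v sameClique u≢v ⟨
        adj G u v  ≡⟨ indep u v (∧-conicalʳ _ _ u∈) (∧-conicalʳ _ _ v∈) ⟩
        false      ∎))
      where
      sameClique : cls 𝒞 u ≡ cls 𝒞 v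
      sameClique = trans (eqF-sound _ _ (∧-conicalˡ _ _ u∈)) (sym (eqF-sound _ _ (∧-conicalˡ _ _ v∈)))
      true≢false : true ≢ false
      true≢false ()

  -- Let I(H - U) lie in a class Φ at degree α′ and I(H) at
  -- degree α′ + 2.  The term of S₁ then lies in Φ at degree
  -- Σ_C (α′ or α′ + 2) = q (α′ + 2) - 2 |S₁|, so x ^ |S₁| times it is
  -- centred at q (α′ + 2) / 2 whatever S₁ is, and so is their sum.

  module Centring (α′ : ℕ) where

    blockDeg : Bool → ℕ
    blockDeg true  = α′
    blockDeg false = suc (suc α′)

    blocksDeg : ∀ r → (Fin r → Bool) → ℕ
    blocksDeg r meets = sum (blockDeg ∘ meets)

    -- every clique met lowers the degree by two
    blocksDeg-balance : ∀ r meets →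
      blocksDeg r meets + (sum (bit ∘ meets) + sum (bit ∘ meets)) ≡ r * suc (suc α′)
    blocksDeg-balance zero    meets = refl
    blocksDeg-balance (suc r) meets =
      trans (regroup (blockDeg (meets Fin.zero)) (blocksDeg r (meets ∘ Fin.suc))
                     (bit (meets Fin.zero)) (sum (bit ∘ meets ∘ Fin.suc)))
            (cong₂ _+_ (one (meets Fin.zero)) (blocksDeg-balance r (meets ∘ Fin.suc)))
      where
      regroup : ∀ x d b B → (x + d) + ((b + B) + (b + B)) ≡ (x + (b + b)) + (d + (B + B))
      regroup = solve 4 (λ x d b B → (x :+ d) :+ ((b :+ B) :+ (b :+ B)) := (x :+ (b :+ b)) :+ (d :+ (B :+ B))) refl
      one : ∀ b → blockDeg b + (bit b + bit b) ≡ suc (suc α′)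
      one true  = +-comm α′ 2
      one false = +-identityʳ _

    module _ {Φ : ℕ → Poly → Set} (class : CentredClass Φ)
             (Φ-H-U : Φ α′ (blockPoly true)) (Φ-H : Φ (suc (suc α′)) (blockPoly false)) where
      open CentredClass class

      Φ-block : ∀ b → Φ (blockDeg b) (blockPoly b)
      Φ-block true  = Φ-H-U
      Φ-block false = Φ-H

      Φ-blocks : ∀ r meets → Φ (blocksDeg r meets) (blocksPoly r meets)
      Φ-blocks zero    meets = has-1p
      Φ-blocks (suc r) meets = closed-mul (Φ-block (meets Fin.zero)) (Φ-blocks r (meets ∘ Fin.suc))

      term-centred : ∀ S₁ b → independentᵇ (adj G) S₁ ≡ b →
        CentredTerm Φ (q * suc (suc α′)) ∣ S₁ ∣ (if b then blocksPoly q (meets S₁) else 0p)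
      term-centred S₁ false _     = inj₁ (λ _ → refl)
      term-centred S₁ true  indep = inj₂ (blocksDeg q (meets S₁) , balance , Φ-blocks q (meets S₁))
        where
        balance : blocksDeg q (meets S₁) + (∣ S₁ ∣ + ∣ S₁ ∣) ≡ q * suc (suc α′)
        balance rewrite size-meets S₁ (independentᵇ-sound (adj G) S₁ indep) = blocksDeg-balance q (meets S₁)

      Φ-product : Φ (q * suc (suc α′)) (indepCount P ⊤)
      Φ-product = respects (≗-sym indepCount-product)
        (centred-subsetSum class n 0 _ term (λ S₁ → term-centred S₁ (independentᵇ (adj G) S₁) refl))

palindromic-indep : ∀ {N} (adj : Fin N → Fin N → Bool) W →
  IndepSymmetric adj W → Palindromic (indepNum adj W) (indepCount adj W)
palindromic-indep adj W sym-I .mirror = sym-I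
palindromic-indep adj W sym-I .vanish = sizeCount-beyond (indepSets adj W)

rising-of-unimodal : ∀ {D a} → Palindromic D a → Unimodal a D → PalUnimodal D a
rising-of-unimodal pa _ .palindromic = pa
rising-of-unimodal {D} {a} pa (peak , _ , up , down) .rising k 2k+2≤D with k <? peak
... | yes k<peak = up k k<peak
... | no k≮peak  = subst₂ _≤_ (sym (trans (mirror pa k k≤D) (cong a D∸k≡1+j)))
                              (sym (mirror pa (suc k) k<D))
                              (down j (≤-trans (≮⇒≥ k≮peak) k≤j) j<D)
  where
  -- j = D - (k + 1) mirrors k + 1, and j + 1 mirrors k
  j = D ∸ suc k
  k+[k+1]≤D : k + suc k ≤ D
  k+[k+1]≤D = ≤-trans (≤-reflexive (+-suc k k)) (≤-trans (n≤1+n _) 2k+2≤D)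
  k<D : k < D
  k<D = ≤-trans (s≤s (m≤m+n k k)) (≤-trans (n≤1+n _) 2k+2≤D)
  k≤D = <⇒≤ k<D
  D∸k≡1+j : D ∸ k ≡ suc j
  D∸k≡1+j = +-∸-assoc 1 k<D
  k≤j : k ≤ j
  k≤j = subst (_≤ j) (m+n∸n≡m k (suc k)) (∸-monoˡ-≤ (suc k) k+[k+1]≤D)
  j<D : j < D
  j<D = subst (_≤ D) D∸k≡1+j (m∸n≤m D k)

-- a peak at ⌊D/2⌋
half : ∀ D → ∃ λ h → h + h ≤ D × D ≤ suc (h + h)
half zero = 0 , z≤n , z≤n
half (suc D) with half D
... | h , 2h≤D , D≤2h+1 with m≤n⇒m<n∨m≡n D≤2h+1
...   | inj₁ (s≤s D≤2h) = h , ≤-trans 2h≤D (n≤1+n D) , s≤s D≤2h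
...   | inj₂ refl       = suc h , ≤-reflexive (cong suc (+-suc h h)) , s≤s (s≤s (+-monoʳ-≤ h (n≤1+n h)))

unimodal-of-rising : ∀ {D a} → PalUnimodal D a → Unimodal a D
unimodal-of-rising {D} {a} pu with half D
... | h , 2h≤D , D≤2h+1 = h , ≤-trans (m≤m+n h h) 2h≤D , up , down
  where
  up : ∀ k → k < h → a k ≤ a (suc k)
  up k k<h = rising pu k (≤-trans (≤-reflexive (cong suc (sym (+-suc k k)))) (≤-trans (+-mono-≤ k<h k<h) 2h≤D))
  -- by symmetry, a (k + 1) is a coefficient further from the centre than a k
  down : ∀ k → h ≤ k → k < D → a (suc k) ≤ a k
  down k h≤k k<D = subst (_≤ a k) (sym (mirror (palindromic pu) (suc k) k<D))
                         (towards-centre pu (D ∸ suc k) k mirrored≤k mirrored+k≤D)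
    where
    mirrored≤k : D ∸ suc k ≤ k
    mirrored≤k = subst (D ∸ suc k ≤_) (m+n∸n≡m k k) (∸-monoˡ-≤ (suc k) (≤-trans D≤2h+1 (s≤s (+-mono-≤ h≤k h≤k))))
    mirrored+k≤D : D ∸ suc k + k ≤ D
    mirrored+k≤D = ≤-trans (+-monoʳ-≤ (D ∸ suc k) (n≤1+n k)) (≤-reflexive (m∸n+n≡m k<D))

-- the product's α is the centre's double: i₀ = 1 sits at degree 0, so the top coefficient is 1
indepNum-of-palindromic : ∀ {N} (adj : Fin N → Fin N → Bool) D →
  Palindromic D (indepCount adj ⊤) → indepNum adj ⊤ ≡ D
indepNum-of-palindromic adj D pal = indepNum-unique adj ⊤ D (vanish pal) top≢0
  where
  top≢0 : indepCount adj ⊤ D ≢ 0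
  top≢0 top≡0 = 1+n≢0 (trans (sym (indepCount-0 adj ⊤)) (trans (mirror pal 0 z≤n) top≡0))

proposition3p2 : ∀ {n m q : ℕ} (G : Graph n) (H : Graph m)
    (𝒞 : CliqueCover G q) (U : Subset m) →
    indepNum (adj H) ⊤ ≡ indepNum (adj H) (∁ U) + 2 →
    ((IndepSymmetric (adj H) ⊤ → IndepSymmetric (adj H) (∁ U) →
      IndepSymmetric (productAdj G 𝒞 H U) ⊤)
    × (IndepSymmetric (adj H) ⊤ × IndepUnimodal (adj H) ⊤ →
       IndepSymmetric (adj H) (∁ U) × IndepUnimodal (adj H) (∁ U) →
       IndepSymmetric (productAdj G 𝒞 H U) ⊤ × IndepUnimodal (productAdj G 𝒞 H U) ⊤))
proposition3p2 {n} {m} {q} G H 𝒞 U α≡α′+2 = symmetric , symmetric-unimodal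
  where
  open ProductGraph G H 𝒞 U
  α′ = indepNum (adj H) (∁ U)
  open Centring α′

  α≡2+α′ : indepNum (adj H) ⊤ ≡ suc (suc α′)
  α≡2+α′ = trans α≡α′+2 (+-comm α′ 2)

  pal-H-U : IndepSymmetric (adj H) (∁ U) → Palindromic α′ (blockPoly true)
  pal-H-U sym-I = pal-cong (indepCount-subsetSum (adj H) (∁ U)) (palindromic-indep (adj H) (∁ U) sym-I)
  pal-H : IndepSymmetric (adj H) ⊤ → Palindromic (suc (suc α′)) (blockPoly false)
  pal-H sym-I = subst (λ d → Palindromic d (blockPoly false)) α≡2+α′
                      (pal-cong (indepCount-subsetSum (adj H) ⊤) (palindromic-indep (adj H) ⊤ sym-I))

  α-product : Palindromic (q * suc (suc α′)) (indepCount P ⊤) → indepNum P ⊤ ≡ q * suc (suc α′)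
  α-product = indepNum-of-palindromic P (q * suc (suc α′))

  symmetric : IndepSymmetric (adj H) ⊤ → IndepSymmetric (adj H) (∁ U) → IndepSymmetric P ⊤
  symmetric sym-H sym-H-U = subst (Symmetric (indepCount P ⊤)) (sym (α-product pal)) (mirror pal)
    where
    pal = Φ-product palindromicClass (pal-H-U sym-H-U) (pal-H sym-H)

  symmetric-unimodal : IndepSymmetric (adj H) ⊤ × IndepUnimodal (adj H) ⊤ →
    IndepSymmetric (adj H) (∁ U) × IndepUnimodal (adj H) (∁ U) → IndepSymmetric P ⊤ × IndepUnimodal P ⊤
  symmetric-unimodal (sym-H , uni-H) (sym-H-U , uni-H-U) =
      subst (Symmetric (indepCount P ⊤)) α≡ (mirror (palindromic pu))
    , subst (Unimodal (indepCount P ⊤)) α≡ (unimodal-of-rising pu)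
    where
    pu-H-U : PalUnimodal α′ (blockPoly true)
    pu-H-U = pu-cong (indepCount-subsetSum (adj H) (∁ U))
               (rising-of-unimodal (palindromic-indep (adj H) (∁ U) sym-H-U) uni-H-U)
    pu-H : PalUnimodal (suc (suc α′)) (blockPoly false)
    pu-H = subst (λ d → PalUnimodal d (blockPoly false)) α≡2+α′
             (pu-cong (indepCount-subsetSum (adj H) ⊤) (rising-of-unimodal (palindromic-indep (adj H) ⊤ sym-H) uni-H))
    pu = Φ-product palUnimodalClass pu-H-U pu-H
    α≡ = sym (α-product (palindromic pu))
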